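{- For any $k\in\mathbb{N}$ there exist graphs $G$ and $H$ such that $\mu^{ - }(G)-\mu^{ - }_t(G)=k$ and $\mu^{ - }_t(H)-\mu^{ - }(H)=k$.
   Context: For $X\subseteq V(G)$, two vertices $a,b$ are $X$-visible if there is a shortest $a,b$-path $P$ with $V(P)\cap X\subseteq\{a,b\}$. $X$ is a mutual-visibility set if every two vertices of $X$ are $X$-visible, and a total mutual-visibility set if every two vertices of $G$ are $X$-visible; such a set is maximal if no proper superset has the same property (the empty set is allowed as a total mutual-visibility set). $\mu^{ - }(G)$ (resp. $\mu^{ - }_t(G)$) is the minimum cardinality of a maximal mutual-visibility (resp. maximal total mutual-visibility) set. -}

module Defs where

open import Data.Nat using (ℕ; zero; suc; _≤_)
open import Data.Bool using (Bool; true; false; T)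
open import Data.Fin using (Fin)
open import Data.Fin.Subset using (Subset; _∈_; _⊂_; ∣_∣)
open import Data.Product using (Σ; _×_; ∃; _,_)
open import Data.Sum using (_⊎_)
open import Relation.Nullary using (¬_)
open import Relation.Binary.PropositionalEquality using (_≡_)

record Graph : Set where
  field
    n      : ℕ
    adj    : Fin n → Fin n → Bool
    sym    : ∀ x y → adj x y ≡ adj y x
    irrefl : ∀ x → adj x x ≡ false

open Graph public

V : Graph → Set
V G = Fin (n G)

Adj : (G : Graph) → V G → V G → Set
Adj G x y = T (adj G x y)

data Walk (G : Graph) : V G → V G → Set where
  []  : ∀ {a} → Walk G a a
  _∷_ : ∀ {a b c} → Adj G a b → Walk G b c → Walk G a c

len : ∀ {G a b} → Walk G a b → ℕ
len []      = zero
len (_ ∷ w) = suc (len w)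

data OnWalk {G : Graph} (v : V G) : ∀ {a b} → Walk G a b → Set where
  here  : ∀ {b} {w : Walk G v b} → OnWalk v w
  there : ∀ {a b c} {e : Adj G a b} {w : Walk G b c} → OnWalk v w → OnWalk v (e ∷ w)

Connected : Graph → Set
Connected G = ∀ (a b : V G) → Walk G a b

-- P is a shortest a,b-path (a walk of minimum length; such walks are paths).
IsShortest : ∀ {G a b} → Walk G a b → Set
IsShortest {G} {a} {b} P = ∀ (Q : Walk G a b) → len P ≤ len Q

Visible : (G : Graph) → Subset (n G) → V G → V G → Set
Visible G X a b =
  Σ (Walk G a b) λ P → IsShortest P ×
    (∀ v → OnWalk v P → v ∈ X → (v ≡ a ⊎ v ≡ b))

IsMutualVisibility : (G : Graph) → Subset (n G) → Set
IsMutualVisibility G X = ∀ a b → a ∈ X → b ∈ X → Visible G X a b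

IsTotalMutualVisibility : (G : Graph) → Subset (n G) → Set
IsTotalMutualVisibility G X = ∀ a b → Visible G X a b

Maximal : (G : Graph) → (Subset (n G) → Set) → Subset (n G) → Set
Maximal G P X = P X × (∀ Y → X ⊂ Y → ¬ P Y)

IsMinMaximal : (G : Graph) → (Subset (n G) → Set) → ℕ → Set
IsMinMaximal G P m =
  (Σ (Subset (n G)) λ X → Maximal G P X × ∣ X ∣ ≡ m) ×
  (∀ X → Maximal G P X → m ≤ ∣ X ∣)

IsMuMinus : Graph → ℕ → Set
IsMuMinus G = IsMinMaximal G (IsMutualVisibility G)

IsMuTMinus : Graph → ℕ → Set
IsMuTMinus G = IsMinMaximal G (IsTotalMutualVisibility G)

-- In the star K₁,ₗ (l ≥ 2) two leaves see each other only through the centre, so a set is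
-- total mutual-visibility iff it avoids the centre: the l leaves are the only maximal such
-- set, while the centre together with one leaf is already a maximal mutual-visibility set.
-- In the prism K_m □ K₂ the only common neighbours of (i,0) and (j,1), i ≠ j, are (j,0) and
-- (i,1). Hence a set is mutual-visibility iff it contains at most one whole column, and total
-- iff no two of its vertices differ in both layer and column. A maximal mutual-visibility set
-- meets every column and contains a whole one, so it has at least m + 1 vertices, whereas a
-- single column is a maximal total set. Take l = k + 2 and m = k + 1.

module Submission where

open import Defs hiding (sym)

open import Data.Bool using (Bool; true; false; T; not)
open import Data.Empty using (⊥; ⊥-elim)
open import Data.Fin using (Fin; zero; suc; _↑ˡ_; _↑ʳ_; splitAt; join; _≟_)
open import Data.Fin.Properties
  using (any?; suc-injective; ↑ˡ-injective; ↑ʳ-injective; splitAt-↑ˡ; splitAt-↑ʳ; splitAt⁻¹-↑ˡ; splitAt⁻¹-↑ʳ; splitAt-join)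
open import Data.Fin.Subset using (Subset; inside; outside; _∈_; _∉_; _⊆_; _⊂_; ∣_∣; _∪_; _∩_; ⁅_⁆)
  renaming (⊥ to ∅; ⊤ to full)
open import Data.Fin.Subset.Properties
  using (_∈?_; nonempty?; ∈⊤; ∉⊥; x∈⁅x⁆; x∈⁅y⁆⇒x≡y; ∣⊤∣≡n; ∣⊥∣≡0; ∣⁅x⁆∣≡1; x∈p∪q⁺; x∈p∪q⁻; x∈p∩q⁺; x∈p∩q⁻; p⊆p∪q; p⊆q⇒∣p∣≤∣q∣; x∈p⇒∣p-x∣<∣p∣; x∈p∧x≢y⇒x∈p-y; Empty-unique)
open import Data.Nat using (ℕ; suc; _+_; _≤_; z≤n; s≤s; s≤s⁻¹; _≤?_)
open import Data.Nat.Properties using (≤-trans; ≤-reflexive; ≰⇒>; +-comm; +-suc; +-identityʳ; +-mono-≤; module ≤-Reasoning)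
open import Data.Product using (Σ; _×_; ∃; _,_; proj₁; proj₂)
open import Data.Sum using (_⊎_; inj₁; inj₂; [_,_]′; swap)
import Data.Sum as Sum
open import Data.Unit using (⊤; tt)
open import Data.Vec using ([]; _∷_; _++_; there)
import Data.Vec as Vec
open import Data.Vec.Properties using (lookup-++ˡ; lookup-++ʳ; []=⇒lookup; lookup⇒[]=)
open import Function using (_∘_; id; case_of_)
open import Relation.Nullary using (¬_; yes; no)
open import Relation.Nullary.Decidable using (isYes; isNo; toWitness; fromWitness; fromWitnessFalse; _×-dec_)
open import Relation.Binary.PropositionalEquality
  using (_≡_; _≢_; refl; sym; trans; cong; cong₂; subst; module ≡-Reasoning)

∣p∪q∣+∣p∩q∣≡∣p∣+∣q∣ : ∀ {n} (p q : Subset n) → ∣ p ∪ q ∣ + ∣ p ∩ q ∣ ≡ ∣ p ∣ + ∣ q ∣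
∣p∪q∣+∣p∩q∣≡∣p∣+∣q∣ [] [] = refl
∣p∪q∣+∣p∩q∣≡∣p∣+∣q∣ (inside ∷ p) (inside ∷ q) =
  cong suc (trans (+-suc _ _) (trans (cong suc (∣p∪q∣+∣p∩q∣≡∣p∣+∣q∣ p q)) (sym (+-suc _ _))))
∣p∪q∣+∣p∩q∣≡∣p∣+∣q∣ (inside ∷ p) (outside ∷ q) = cong suc (∣p∪q∣+∣p∩q∣≡∣p∣+∣q∣ p q)
∣p∪q∣+∣p∩q∣≡∣p∣+∣q∣ (outside ∷ p) (inside ∷ q) =
  trans (cong suc (∣p∪q∣+∣p∩q∣≡∣p∣+∣q∣ p q)) (sym (+-suc _ _))
∣p∪q∣+∣p∩q∣≡∣p∣+∣q∣ (outside ∷ p) (outside ∷ q) = ∣p∪q∣+∣p∩q∣≡∣p∣+∣q∣ p q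

∣p++q∣≡∣p∣+∣q∣ : ∀ {m n} (p : Subset m) (q : Subset n) → ∣ p ++ q ∣ ≡ ∣ p ∣ + ∣ q ∣
∣p++q∣≡∣p∣+∣q∣ [] q = refl
∣p++q∣≡∣p∣+∣q∣ (inside ∷ p) q = cong suc (∣p++q∣≡∣p∣+∣q∣ p q)
∣p++q∣≡∣p∣+∣q∣ (outside ∷ p) q = ∣p++q∣≡∣p∣+∣q∣ p q

module _ {n : ℕ} where

  ∈⇒1≤∣p∣ : ∀ {p : Subset n} {x} → x ∈ p → 1 ≤ ∣ p ∣
  ∈⇒1≤∣p∣ x∈p = ≤-trans (s≤s z≤n) (x∈p⇒∣p-x∣<∣p∣ x∈p)

  distinct∈⇒2≤∣p∣ : ∀ {p : Subset n} {x y} → x ∈ p → y ∈ p → y ≢ x → 2 ≤ ∣ p ∣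
  distinct∈⇒2≤∣p∣ x∈p y∈p y≢x =
    ≤-trans (s≤s (∈⇒1≤∣p∣ (x∈p∧x≢y⇒x∈p-y y∈p y≢x))) (x∈p⇒∣p-x∣<∣p∣ x∈p)

  ∣p∣≤1⇒⊆⁅x⁆ : ∀ {p : Subset n} → Fin n → ∣ p ∣ ≤ 1 → ∃ λ x → p ⊆ ⁅ x ⁆
  ∣p∣≤1⇒⊆⁅x⁆ {p} x₀ ∣p∣≤1 with nonempty? p
  ... | no p-empty = x₀ , λ {y} y∈p → ⊥-elim (p-empty (y , y∈p))
  ... | yes (x , x∈p) = x , λ {y} y∈p → case y ≟ x of λ where
    (yes refl) → x∈⁅x⁆ x
    (no y≢x)   → case ≤-trans (distinct∈⇒2≤∣p∣ x∈p y∈p y≢x) ∣p∣≤1 of λ where (s≤s ())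

  full⊆p⇒n≤∣p∣ : ∀ {p : Subset n} → full ⊆ p → n ≤ ∣ p ∣
  full⊆p⇒n≤∣p∣ full⊆p = ≤-trans (≤-reflexive (sym (∣⊤∣≡n n))) (p⊆q⇒∣p∣≤∣q∣ full⊆p)

  ∣⁅x⁆∪⁅y⁆∣≡2 : ∀ {x y : Fin n} → x ≢ y → ∣ ⁅ x ⁆ ∪ ⁅ y ⁆ ∣ ≡ 2
  ∣⁅x⁆∪⁅y⁆∣≡2 {x} {y} x≢y = begin
    ∣ ⁅ x ⁆ ∪ ⁅ y ⁆ ∣                       ≡⟨ sym (+-identityʳ _) ⟩
    ∣ ⁅ x ⁆ ∪ ⁅ y ⁆ ∣ + 0                   ≡⟨ cong (∣ ⁅ x ⁆ ∪ ⁅ y ⁆ ∣ +_) (sym ∣⁅x⁆∩⁅y⁆∣≡0) ⟩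
    ∣ ⁅ x ⁆ ∪ ⁅ y ⁆ ∣ + ∣ ⁅ x ⁆ ∩ ⁅ y ⁆ ∣   ≡⟨ ∣p∪q∣+∣p∩q∣≡∣p∣+∣q∣ ⁅ x ⁆ ⁅ y ⁆ ⟩
    ∣ ⁅ x ⁆ ∣ + ∣ ⁅ y ⁆ ∣                   ≡⟨ cong₂ _+_ (∣⁅x⁆∣≡1 x) (∣⁅x⁆∣≡1 y) ⟩
    2                                       ∎
    where
    open ≡-Reasoning
    ∣⁅x⁆∩⁅y⁆∣≡0 : ∣ ⁅ x ⁆ ∩ ⁅ y ⁆ ∣ ≡ 0
    ∣⁅x⁆∩⁅y⁆∣≡0 = trans (cong ∣_∣ (Empty-unique λ (z , z∈) →
      let z∈⁅x⁆ , z∈⁅y⁆ = x∈p∩q⁻ ⁅ x ⁆ ⁅ y ⁆ z∈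
      in x≢y (trans (sym (x∈⁅y⁆⇒x≡y x z∈⁅x⁆)) (x∈⁅y⁆⇒x≡y y z∈⁅y⁆)))) (∣⊥∣≡0 n)

  ∈-∪⁅⁆⁻ : ∀ {p : Subset n} {x y} → x ∈ p ∪ ⁅ y ⁆ → x ∈ p ⊎ x ≡ y
  ∈-∪⁅⁆⁻ {p} {y = y} = Sum.map₂ (x∈⁅y⁆⇒x≡y y) ∘ x∈p∪q⁻ p ⁅ y ⁆

  ∈-∪⁅⁆-≢ : ∀ {p : Subset n} {x y} → x ≢ y → x ∈ p ∪ ⁅ y ⁆ → x ∈ p
  ∈-∪⁅⁆-≢ x≢y = [ id , ⊥-elim ∘ x≢y ]′ ∘ ∈-∪⁅⁆⁻

  ∈-pairˡ : ∀ {x y : Fin n} → x ∈ ⁅ x ⁆ ∪ ⁅ y ⁆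
  ∈-pairˡ {x} = x∈p∪q⁺ (inj₁ (x∈⁅x⁆ x))

  ∈-pairʳ : ∀ {x y : Fin n} → y ∈ ⁅ x ⁆ ∪ ⁅ y ⁆
  ∈-pairʳ {y = y} = x∈p∪q⁺ (inj₂ (x∈⁅x⁆ y))

  ∈-pair⁻ : ∀ {x y z : Fin n} → z ∈ ⁅ x ⁆ ∪ ⁅ y ⁆ → z ≡ x ⊎ z ≡ y
  ∈-pair⁻ {x} = Sum.map₁ (x∈⁅y⁆⇒x≡y x) ∘ ∈-∪⁅⁆⁻

module _ {m n : ℕ} where

  ∈-++ˡ⁺ : ∀ (p : Subset m) (q : Subset n) {i} → i ∈ p → i ↑ˡ n ∈ p ++ q
  ∈-++ˡ⁺ p q {i} i∈p = lookup⇒[]= _ (p ++ q) (trans (lookup-++ˡ p q i) ([]=⇒lookup i∈p))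

  ∈-++ˡ⁻ : ∀ (p : Subset m) (q : Subset n) {i} → i ↑ˡ n ∈ p ++ q → i ∈ p
  ∈-++ˡ⁻ p q {i} i∈p++q = lookup⇒[]= i p (trans (sym (lookup-++ˡ p q i)) ([]=⇒lookup i∈p++q))

  ∈-++ʳ⁺ : ∀ (p : Subset m) (q : Subset n) {i} → i ∈ q → m ↑ʳ i ∈ p ++ q
  ∈-++ʳ⁺ p q {i} i∈q = lookup⇒[]= _ (p ++ q) (trans (lookup-++ʳ p q i) ([]=⇒lookup i∈q))

  ∈-++ʳ⁻ : ∀ (p : Subset m) (q : Subset n) {i} → m ↑ʳ i ∈ p ++ q → i ∈ q
  ∈-++ʳ⁻ p q {i} i∈p++q = lookup⇒[]= i q (trans (sym (lookup-++ʳ p q i)) ([]=⇒lookup i∈p++q))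

module _ {G : Graph} where

  adj-irrefl : ∀ {a} → ¬ Adj G a a
  adj-irrefl {a} = subst T (irrefl G a)

  adj-sym : ∀ {a b} → Adj G a b → Adj G b a
  adj-sym {a} {b} = subst T (Graph.sym G a b)

  len≥2 : ∀ {a b} → a ≢ b → ¬ Adj G a b → (Q : Walk G a b) → 2 ≤ len Q
  len≥2 a≢b ¬a~b []              = ⊥-elim (a≢b refl)
  len≥2 a≢b ¬a~b (a~b ∷ [])      = ⊥-elim (¬a~b a~b)
  len≥2 a≢b ¬a~b (_ ∷ _ ∷ _)     = s≤s (s≤s z≤n)

  visible-refl : ∀ X a → Visible G X a a
  visible-refl X a = [] , (λ _ → z≤n) , λ { v here _ → inj₁ refl }

  visible-adjacent : ∀ X {a b} → Adj G a b → Visible G X a b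
  visible-adjacent X a~b = a~b ∷ [] , shortest , λ where
      v here _         → inj₁ refl
      v (there here) _ → inj₂ refl
    where
    shortest : ∀ Q → 1 ≤ len Q
    shortest []      = ⊥-elim (adj-irrefl a~b)
    shortest (_ ∷ _) = s≤s z≤n

  visible-via : ∀ X {a b c} → a ≢ b → ¬ Adj G a b → Adj G a c → Adj G c b → c ∉ X →
                Visible G X a b
  visible-via X a≢b ¬a~b a~c c~b c∉X = a~c ∷ c~b ∷ [] , len≥2 a≢b ¬a~b , λ where
    v here _                 → inj₁ refl
    v (there here) v∈X       → ⊥-elim (c∉X v∈X)
    v (there (there here)) _ → inj₂ refl

  common-neighbours⊆X⇒¬visible : ∀ X {a b c} → a ≢ b → ¬ Adj G a b → Adj G a c → Adj G c b →
    (∀ c → Adj G a c → Adj G c b → c ∈ X) → ¬ Visible G X a b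
  common-neighbours⊆X⇒¬visible X {a} {b} a≢b ¬a~b a~c c~b common⊆X (P , shortest , avoids) =
    through-X P (shortest (a~c ∷ c~b ∷ [])) avoids
    where
    through-X : (P : Walk G a b) → len P ≤ 2 →
                ¬ (∀ v → OnWalk v P → v ∈ X → v ≡ a ⊎ v ≡ b)
    through-X []                 _ _ = a≢b refl
    through-X (a~b ∷ [])         _ _ = ¬a~b a~b
    through-X (_∷_ {b = c} a~c (c~b ∷ [])) _ avoids with avoids c (there here) (common⊆X c a~c c~b)
    ... | inj₁ refl = adj-irrefl a~c
    ... | inj₂ refl = adj-irrefl c~b
    through-X (_ ∷ _ ∷ _ ∷ _) (s≤s (s≤s ()))

  visible-⊆ : ∀ {X Y a b} → Y ⊆ X → Visible G X a b → Visible G Y a b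
  visible-⊆ Y⊆X (P , shortest , avoids) = P , shortest , λ v v∈P v∈Y → avoids v v∈P (Y⊆X v∈Y)

  mutual-⊆ : ∀ {X Y} → Y ⊆ X → IsMutualVisibility G X → IsMutualVisibility G Y
  mutual-⊆ Y⊆X X-mutual a b a∈Y b∈Y = visible-⊆ Y⊆X (X-mutual a b (Y⊆X a∈Y) (Y⊆X b∈Y))

  total-⊆ : ∀ {X Y} → Y ⊆ X → IsTotalMutualVisibility G X → IsTotalMutualVisibility G Y
  total-⊆ Y⊆X X-total a b = visible-⊆ Y⊆X (X-total a b)

  total⇒connected : ∀ {X} → IsTotalMutualVisibility G X → Connected G
  total⇒connected X-total a b = proj₁ (X-total a b)

  adjacent-pair-mutual : ∀ {x y} → Adj G x y → IsMutualVisibility G (⁅ x ⁆ ∪ ⁅ y ⁆)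
  adjacent-pair-mutual {x} {y} x~y a b a∈ b∈ with ∈-pair⁻ a∈ | ∈-pair⁻ b∈
  ... | inj₁ refl | inj₁ refl = visible-refl _ x
  ... | inj₁ refl | inj₂ refl = visible-adjacent _ x~y
  ... | inj₂ refl | inj₁ refl = visible-adjacent _ (adj-sym x~y)
  ... | inj₂ refl | inj₂ refl = visible-refl _ y

  maximal⇒¬∪⁅⁆ : ∀ {P X x} → Maximal G P X → x ∉ X → ¬ P (X ∪ ⁅ x ⁆)
  maximal⇒¬∪⁅⁆ {x = x} (_ , maximal) x∉X =
    maximal _ (p⊆p∪q ⁅ x ⁆ , x , x∈p∪q⁺ (inj₂ (x∈⁅x⁆ x)) , x∉X)

  2≤∣maximal∣ : ∀ {P : Subset (n G) → Set} → (∀ {X Y} → Y ⊆ X → P X → P Y) → V G →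
    (∀ x → ∃ λ y → y ≢ x × P (⁅ x ⁆ ∪ ⁅ y ⁆)) → ∀ {X} → Maximal G P X → 2 ≤ ∣ X ∣
  2≤∣maximal∣ P-⊆ x₀ partner {X} maximal with 2 ≤? ∣ X ∣
  ... | yes 2≤∣X∣ = 2≤∣X∣
  ... | no 2≰∣X∣ =
    let x , X⊆⁅x⁆ = ∣p∣≤1⇒⊆⁅x⁆ x₀ (s≤s⁻¹ (≰⇒> 2≰∣X∣))
        y , y≢x , P-pair = partner x
        X∪⁅y⁆⊆pair : X ∪ ⁅ y ⁆ ⊆ ⁅ x ⁆ ∪ ⁅ y ⁆
        X∪⁅y⁆⊆pair = x∈p∪q⁺ ∘ Sum.map₁ X⊆⁅x⁆ ∘ x∈p∪q⁻ X ⁅ y ⁆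
    in ⊥-elim (maximal⇒¬∪⁅⁆ maximal (y≢x ∘ x∈⁅y⁆⇒x≡y x ∘ X⊆⁅x⁆) (P-⊆ X∪⁅y⁆⊆pair P-pair))

star-adj : ∀ {l} → Fin (suc l) → Fin (suc l) → Bool
star-adj zero    zero    = false
star-adj zero    (suc _) = true
star-adj (suc _) zero    = true
star-adj (suc _) (suc _) = false

star-adj-sym : ∀ {l} (x y : Fin (suc l)) → star-adj x y ≡ star-adj y x
star-adj-sym zero    zero    = refl
star-adj-sym zero    (suc _) = refl
star-adj-sym (suc _) zero    = refl
star-adj-sym (suc _) (suc _) = refl

star-adj-irrefl : ∀ {l} (x : Fin (suc l)) → star-adj x x ≡ false
star-adj-irrefl zero    = refl
star-adj-irrefl (suc _) = refl

Star : ℕ → Graph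
Star l = record { n = suc l ; adj = star-adj ; sym = star-adj-sym ; irrefl = star-adj-irrefl }

module _ {l : ℕ} where

  centre∉⇒total : ∀ {Y} → zero ∉ Y → IsTotalMutualVisibility (Star l) Y
  centre∉⇒total {Y} centre∉Y zero    zero    = visible-refl Y zero
  centre∉⇒total {Y} centre∉Y zero    (suc j) = visible-adjacent Y tt
  centre∉⇒total {Y} centre∉Y (suc i) zero    = visible-adjacent Y tt
  centre∉⇒total {Y} centre∉Y (suc i) (suc j) with i ≟ j
  ... | yes refl = visible-refl Y (suc i)
  ... | no i≢j   = visible-via Y (i≢j ∘ suc-injective) (λ ()) tt tt centre∉Y

  centre∈⇒leaves-invisible : ∀ {Y} {i j : Fin l} → zero ∈ Y → i ≢ j →
                             ¬ Visible (Star l) Y (suc i) (suc j)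
  centre∈⇒leaves-invisible {Y} centre∈Y i≢j =
    common-neighbours⊆X⇒¬visible Y {c = zero} (i≢j ∘ suc-injective) (λ ()) tt tt λ where
      zero    _ _ → centre∈Y
      (suc _) () _

  star-connected : Connected (Star l)
  star-connected = total⇒connected (centre∉⇒total {Y = ∅} ∉⊥)

module _ (k : ℕ) where

  private
    l : ℕ
    l = suc (suc k)

  total⇒centre∉ : ∀ {Y} → IsTotalMutualVisibility (Star l) Y → zero ∉ Y
  total⇒centre∉ Y-total centre∈Y =
    centre∈⇒leaves-invisible centre∈Y (λ ()) (Y-total (suc zero) (suc (suc zero)))

  leaves : Subset (suc l)
  leaves = outside ∷ full

  leaves-maximal : Maximal (Star l) (IsTotalMutualVisibility (Star l)) leaves
  leaves-maximal = centre∉⇒total (λ ()) , no-total-superset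
    where
    no-total-superset : ∀ Y → leaves ⊂ Y → ¬ IsTotalMutualVisibility (Star l) Y
    no-total-superset Y (_ , zero  , centre∈Y , _)     Y-total = total⇒centre∉ Y-total centre∈Y
    no-total-superset Y (_ , suc j , _        , leaf∉) _       = leaf∉ (there ∈⊤)

  leaves⊆maximal-total : ∀ {X} → Maximal (Star l) (IsTotalMutualVisibility (Star l)) X →
                         leaves ⊆ X
  leaves⊆maximal-total {X} maximal {suc j} _ with suc j ∈? X
  ... | yes leaf∈X = leaf∈X
  ... | no leaf∉X  = ⊥-elim (maximal⇒¬∪⁅⁆ {Star l} maximal leaf∉X
        (centre∉⇒total {l} (total⇒centre∉ (proj₁ maximal) ∘ ∈-∪⁅⁆-≢ {y = suc j} (λ ()))))

  star-μ⁻t : IsMuTMinus (Star l) l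
  star-μ⁻t = (leaves , leaves-maximal , ∣⊤∣≡n l) ,
             λ X maximal → subst (_≤ ∣ X ∣) (∣⊤∣≡n l) (p⊆q⇒∣p∣≤∣q∣ (leaves⊆maximal-total maximal))

  centre-leaf : Subset (suc l)
  centre-leaf = ⁅ zero ⁆ ∪ ⁅ suc zero ⁆

  centre-leaf-maximal : Maximal (Star l) (IsMutualVisibility (Star l)) centre-leaf
  centre-leaf-maximal = adjacent-pair-mutual {Star l} {zero} {suc zero} tt , no-mutual-superset
    where
    centre∈ : zero ∈ centre-leaf
    centre∈ = ∈-pairˡ {x = zero} {suc zero}
    leaf∈ : suc zero ∈ centre-leaf
    leaf∈ = ∈-pairʳ {x = zero} {suc zero}
    no-mutual-superset : ∀ Y → centre-leaf ⊂ Y → ¬ IsMutualVisibility (Star l) Y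
    no-mutual-superset Y (_ , zero , _ , x∉) _ = x∉ centre∈
    no-mutual-superset Y (_ , suc zero , _ , x∉) _ = x∉ leaf∈
    no-mutual-superset Y (pair⊆Y , suc (suc j) , x∈Y , _) Y-mutual =
      centre∈⇒leaves-invisible (pair⊆Y centre∈) (λ ())
        (Y-mutual (suc zero) (suc (suc j)) (pair⊆Y leaf∈) x∈Y)

  star-μ⁻ : IsMuMinus (Star l) 2
  star-μ⁻ = (centre-leaf , centre-leaf-maximal , ∣⁅x⁆∪⁅y⁆∣≡2 {suc l} {zero} {suc zero} (λ ())) ,
            λ X → 2≤∣maximal∣ {Star l} mutual-⊆ zero neighbour
    where
    neighbour : ∀ x → ∃ λ y → y ≢ x × IsMutualVisibility (Star l) (⁅ x ⁆ ∪ ⁅ y ⁆)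
    neighbour zero    = suc zero , (λ ()) , adjacent-pair-mutual {Star l} {zero} {suc zero} tt
    neighbour (suc i) = zero     , (λ ()) , adjacent-pair-mutual {Star l} {suc i} {zero} tt

isYes-≟-sym : ∀ {m} (i j : Fin m) → isYes (i ≟ j) ≡ isYes (j ≟ i)
isYes-≟-sym i j with i ≟ j | j ≟ i
... | yes _   | yes _   = refl
... | no _    | no _    = refl
... | yes i≡j | no j≢i  = ⊥-elim (j≢i (sym i≡j))
... | no i≢j  | yes j≡i = ⊥-elim (i≢j (sym j≡i))

isNo-≟-refl : ∀ {m} (i : Fin m) → isNo (i ≟ i) ≡ false
isNo-≟-refl i with i ≟ i
... | yes _   = refl
... | no i≢i  = ⊥-elim (i≢i refl)

-- inj₁ i and inj₂ i are the vertices (i,0) and (i,1) of K_m □ K₂; Prism m puts them at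
-- i ↑ˡ m and m ↑ʳ i via splitAt.
prism-edge : ∀ {m} → Fin m ⊎ Fin m → Fin m ⊎ Fin m → Bool
prism-edge (inj₁ i) (inj₁ j) = isNo (i ≟ j)
prism-edge (inj₂ i) (inj₂ j) = isNo (i ≟ j)
prism-edge (inj₁ i) (inj₂ j) = isYes (i ≟ j)
prism-edge (inj₂ i) (inj₁ j) = isYes (i ≟ j)

prism-edge-sym : ∀ {m} (s t : Fin m ⊎ Fin m) → prism-edge s t ≡ prism-edge t s
prism-edge-sym (inj₁ i) (inj₁ j) = cong not (isYes-≟-sym i j)
prism-edge-sym (inj₂ i) (inj₂ j) = cong not (isYes-≟-sym i j)
prism-edge-sym (inj₁ i) (inj₂ j) = isYes-≟-sym i j
prism-edge-sym (inj₂ i) (inj₁ j) = isYes-≟-sym i j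

prism-edge-irrefl : ∀ {m} (s : Fin m ⊎ Fin m) → prism-edge s s ≡ false
prism-edge-irrefl (inj₁ i) = isNo-≟-refl i
prism-edge-irrefl (inj₂ i) = isNo-≟-refl i

Prism : ℕ → Graph
Prism m = record
  { n      = m + m
  ; adj    = λ x y → prism-edge (splitAt m x) (splitAt m y)
  ; sym    = λ x y → prism-edge-sym (splitAt m x) (splitAt m y)
  ; irrefl = prism-edge-irrefl ∘ splitAt m
  }

module PrismProperties (m : ℕ) where

  top bottom : Fin m → V (Prism m)
  top i    = i ↑ˡ m
  bottom i = m ↑ʳ i

  layers : Subset m → Subset m → Subset (m + m)
  layers = _++_

  data Layer : V (Prism m) → Set where
    is-top    : ∀ i → Layer (top i)
    is-bottom : ∀ i → Layer (bottom i)

  layer : ∀ x → Layer x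
  layer x with splitAt m x in eq
  ... | inj₁ i = subst Layer (splitAt⁻¹-↑ˡ eq) (is-top i)
  ... | inj₂ i = subst Layer (splitAt⁻¹-↑ʳ eq) (is-bottom i)

  edge⇒adj : ∀ s t → T (prism-edge s t) → Adj (Prism m) (join m m s) (join m m t)
  edge⇒adj s t = subst T (sym (cong₂ prism-edge (splitAt-join m m s) (splitAt-join m m t)))

  adj⇒edge : ∀ s t → Adj (Prism m) (join m m s) (join m m t) → T (prism-edge s t)
  adj⇒edge s t = subst T (cong₂ prism-edge (splitAt-join m m s) (splitAt-join m m t))

  top-adj : ∀ {i j} → i ≢ j → Adj (Prism m) (top i) (top j)
  top-adj i≢j = edge⇒adj (inj₁ _) (inj₁ _) (fromWitnessFalse i≢j)

  bottom-adj : ∀ {i j} → i ≢ j → Adj (Prism m) (bottom i) (bottom j)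
  bottom-adj i≢j = edge⇒adj (inj₂ _) (inj₂ _) (fromWitnessFalse i≢j)

  rung : ∀ {i} → Adj (Prism m) (top i) (bottom i)
  rung = edge⇒adj (inj₁ _) (inj₂ _) (fromWitness refl)

  top-bottom-adj⇒≡ : ∀ {i j} → Adj (Prism m) (top i) (bottom j) → i ≡ j
  top-bottom-adj⇒≡ = toWitness ∘ adj⇒edge (inj₁ _) (inj₂ _)

  top-injective : ∀ {i j} → top i ≡ top j → i ≡ j
  top-injective = ↑ˡ-injective m _ _

  bottom-injective : ∀ {i j} → bottom i ≡ bottom j → i ≡ j
  bottom-injective = ↑ʳ-injective m _ _

  top≢bottom : ∀ {i j} → top i ≢ bottom j
  top≢bottom {i} {j} eq
    with () ← trans (sym (splitAt-↑ˡ m i m)) (trans (cong (splitAt m) eq) (splitAt-↑ʳ m m j))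

  top-bottom-common-neighbour : ∀ {i j c} → Adj (Prism m) (top i) c → Adj (Prism m) c (bottom j) →
                                c ≡ top j ⊎ c ≡ bottom i
  top-bottom-common-neighbour {c = c} i~c c~j with layer c
  ... | is-top l    = inj₁ (cong top (top-bottom-adj⇒≡ c~j))
  ... | is-bottom l = inj₂ (cong bottom (sym (top-bottom-adj⇒≡ i~c)))

  crossing-blocked : ∀ {Y i j} → i ≢ j → top j ∈ Y → bottom i ∈ Y →
                     ¬ Visible (Prism m) Y (top i) (bottom j)
  crossing-blocked {Y} i≢j top-j∈Y bottom-i∈Y =
    common-neighbours⊆X⇒¬visible Y top≢bottom (i≢j ∘ top-bottom-adj⇒≡) (top-adj i≢j) rung
      λ c i~c c~j → [ (λ { refl → top-j∈Y }) , (λ { refl → bottom-i∈Y }) ]′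
                      (top-bottom-common-neighbour i~c c~j)

  rungʳ : ∀ {i} → Adj (Prism m) (bottom i) (top i)
  rungʳ = adj-sym {Prism m} rung

  Detour : Subset (m + m) → Fin m → Fin m → Set
  Detour Y i j = top j ∉ Y ⊎ bottom i ∉ Y

  crossing-visible-via : ∀ {Y i j c} → i ≢ j →
    Adj (Prism m) (top i) c → Adj (Prism m) c (bottom j) → c ∉ Y →
    Visible (Prism m) Y (top i) (bottom j) × Visible (Prism m) Y (bottom j) (top i)
  crossing-visible-via {Y} {i} {j} i≢j i~c c~j c∉Y =
    visible-via Y top≢bottom ¬i~j i~c c~j c∉Y ,
    visible-via Y (top≢bottom ∘ sym) (¬i~j ∘ adj-sym {Prism m})
      (adj-sym {Prism m} c~j) (adj-sym {Prism m} i~c) c∉Y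
    where
    ¬i~j : ¬ Adj (Prism m) (top i) (bottom j)
    ¬i~j = i≢j ∘ top-bottom-adj⇒≡

  detour⇒visible : ∀ {Y i j} → i ≢ j → Detour Y i j →
                   Visible (Prism m) Y (top i) (bottom j) × Visible (Prism m) Y (bottom j) (top i)
  detour⇒visible i≢j (inj₁ top-j∉Y)    = crossing-visible-via i≢j (top-adj i≢j) rung top-j∉Y
  detour⇒visible i≢j (inj₂ bottom-i∉Y) = crossing-visible-via i≢j rung (bottom-adj i≢j) bottom-i∉Y

  visible-if-detours : ∀ {Y} (P : V (Prism m) → Set) {a b} → P a → P b →
    (∀ {i j} → i ≢ j → P (top i) → P (bottom j) → Detour Y i j) → Visible (Prism m) Y a b
  visible-if-detours {Y} P {a} {b} Pa Pb detour with layer a | layer b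
  ... | is-top i    | is-top j    = case i ≟ j of λ where
    (yes refl) → visible-refl Y (top i)
    (no i≢j)   → visible-adjacent Y (top-adj i≢j)
  ... | is-bottom i | is-bottom j = case i ≟ j of λ where
    (yes refl) → visible-refl Y (bottom i)
    (no i≢j)   → visible-adjacent Y (bottom-adj i≢j)
  ... | is-top i    | is-bottom j = case i ≟ j of λ where
    (yes refl) → visible-adjacent Y rung
    (no i≢j)   → proj₁ (detour⇒visible i≢j (detour i≢j Pa Pb))
  ... | is-bottom j | is-top i    = case i ≟ j of λ where
    (yes refl) → visible-adjacent Y rungʳ
    (no i≢j)   → proj₂ (detour⇒visible i≢j (detour i≢j Pb Pa))

  NoCrossing : Subset (m + m) → Set
  NoCrossing Y = ∀ {i j} → top j ∈ Y → bottom i ∈ Y → i ≡ j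

  total⇒no-crossing : ∀ {Y} → IsTotalMutualVisibility (Prism m) Y → NoCrossing Y
  total⇒no-crossing Y-total {i} {j} top-j∈Y bottom-i∈Y with i ≟ j
  ... | yes i≡j = i≡j
  ... | no i≢j  = ⊥-elim (crossing-blocked i≢j top-j∈Y bottom-i∈Y (Y-total (top i) (bottom j)))

  no-crossing⇒total : ∀ {Y} → NoCrossing Y → IsTotalMutualVisibility (Prism m) Y
  no-crossing⇒total {Y} no-crossing a b = visible-if-detours (λ _ → ⊤) tt tt detour
    where
    detour : ∀ {i j} → i ≢ j → ⊤ → ⊤ → Detour Y i j
    detour {i} {j} i≢j _ _ with top j ∈? Y
    ... | no top-j∉Y  = inj₁ top-j∉Y
    ... | yes top-j∈Y = inj₂ (i≢j ∘ no-crossing top-j∈Y)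

  in-column⇒no-crossing : ∀ {Y c} → (∀ {x} → x ∈ Y → x ≡ top c ⊎ x ≡ bottom c) → NoCrossing Y
  in-column⇒no-crossing Y⊆column top-j∈Y bottom-i∈Y with Y⊆column top-j∈Y | Y⊆column bottom-i∈Y
  ... | inj₁ top-j≡top-c | inj₂ bottom-i≡bottom-c =
    trans (bottom-injective bottom-i≡bottom-c) (sym (top-injective top-j≡top-c))
  ... | inj₂ top≡bottom | _ = ⊥-elim (top≢bottom top≡bottom)
  ... | _ | inj₁ bottom≡top = ⊥-elim (top≢bottom (sym bottom≡top))

  Full : Subset (m + m) → Fin m → Set
  Full Y i = top i ∈ Y × bottom i ∈ Y

  AtMostOneFull : Subset (m + m) → Set
  AtMostOneFull Y = ∀ {i j} → Full Y i → Full Y j → i ≡ j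

  mutual⇒at-most-one-full : ∀ {Y} → IsMutualVisibility (Prism m) Y → AtMostOneFull Y
  mutual⇒at-most-one-full Y-mutual {i} {j} (top-i∈Y , bottom-i∈Y) (top-j∈Y , bottom-j∈Y) with i ≟ j
  ... | yes i≡j = i≡j
  ... | no i≢j  = ⊥-elim (crossing-blocked i≢j top-j∈Y bottom-i∈Y
                           (Y-mutual (top i) (bottom j) top-i∈Y bottom-j∈Y))

  at-most-one-full⇒mutual : ∀ {Y} → AtMostOneFull Y → IsMutualVisibility (Prism m) Y
  at-most-one-full⇒mutual {Y} one a b a∈Y b∈Y = visible-if-detours (_∈ Y) a∈Y b∈Y detour
    where
    detour : ∀ {i j} → i ≢ j → top i ∈ Y → bottom j ∈ Y → Detour Y i j
    detour {i} {j} i≢j top-i∈Y bottom-j∈Y with top j ∈? Y | bottom i ∈? Y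
    ... | no top-j∉Y  | _              = inj₁ top-j∉Y
    ... | yes _       | no bottom-i∉Y  = inj₂ bottom-i∉Y
    ... | yes top-j∈Y | yes bottom-i∈Y =
      ⊥-elim (i≢j (one (top-i∈Y , bottom-i∈Y) (top-j∈Y , bottom-j∈Y)))

  full-∪⁅top⁆ : ∀ {X c l} → Full (X ∪ ⁅ top c ⁆) l → Full X l ⊎ l ≡ c
  full-∪⁅top⁆ (top∈ , bottom∈) with ∈-∪⁅⁆⁻ top∈ | ∈-∪⁅⁆⁻ bottom∈
  ... | inj₂ top-l≡top-c | _              = inj₂ (top-injective top-l≡top-c)
  ... | inj₁ top-l∈X     | inj₁ bottom-l∈X = inj₁ (top-l∈X , bottom-l∈X)
  ... | inj₁ _           | inj₂ bottom≡top = ⊥-elim (top≢bottom (sym bottom≡top))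

  full-∪⁅bottom⁆ : ∀ {X c l} → Full (X ∪ ⁅ bottom c ⁆) l → Full X l ⊎ l ≡ c
  full-∪⁅bottom⁆ (top∈ , bottom∈) with ∈-∪⁅⁆⁻ top∈ | ∈-∪⁅⁆⁻ bottom∈
  ... | _          | inj₂ bottom-l≡bottom-c = inj₂ (bottom-injective bottom-l≡bottom-c)
  ... | inj₁ top-l∈X | inj₁ bottom-l∈X      = inj₁ (top-l∈X , bottom-l∈X)
  ... | inj₂ top≡bottom | inj₁ _            = ⊥-elim (top≢bottom top≡bottom)

  column : Fin m → Subset (m + m)
  column c = ⁅ top c ⁆ ∪ ⁅ bottom c ⁆

  top∈column : ∀ c → top c ∈ column c
  top∈column c = ∈-pairˡ

  bottom∈column : ∀ c → bottom c ∈ column c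
  bottom∈column c = ∈-pairʳ

  ∣column∣≡2 : ∀ c → ∣ column c ∣ ≡ 2
  ∣column∣≡2 c = ∣⁅x⁆∪⁅y⁆∣≡2 (top≢bottom {c} {c})

  column-total : ∀ c → IsTotalMutualVisibility (Prism m) (column c)
  column-total c = no-crossing⇒total (in-column⇒no-crossing ∈-pair⁻)

  prism-connected : Connected (Prism m)
  prism-connected = total⇒connected (no-crossing⇒total {∅} (⊥-elim ∘ ∉⊥))

  maximal-mutual-meets-columns : ∀ {X} → Maximal (Prism m) (IsMutualVisibility (Prism m)) X →
                                 ∀ i → top i ∈ X ⊎ bottom i ∈ X
  maximal-mutual-meets-columns {X} maximal i with top i ∈? X | bottom i ∈? X
  ... | yes top-i∈X | _              = inj₁ top-i∈X
  ... | no _        | yes bottom-i∈X = inj₂ bottom-i∈X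
  ... | no top-i∉X  | no bottom-i∉X  = ⊥-elim (maximal⇒¬∪⁅⁆ {Prism m} maximal top-i∉X
        (at-most-one-full⇒mutual λ full full′ → one (still-full full) (still-full full′)))
    where
    one : AtMostOneFull X
    one = mutual⇒at-most-one-full (proj₁ maximal)
    still-full : ∀ {l} → Full (X ∪ ⁅ top i ⁆) l → Full X l
    still-full full@(_ , bottom-l∈) with full-∪⁅top⁆ full
    ... | inj₁ full-X = full-X
    ... | inj₂ refl   = ⊥-elim (bottom-i∉X (∈-∪⁅⁆-≢ (top≢bottom ∘ sym) bottom-l∈))

module _ (k : ℕ) where

  private
    m : ℕ
    m = suc k

  open PrismProperties m

  maximal-mutual-has-full : ∀ {X} → Maximal (Prism m) (IsMutualVisibility (Prism m)) X →
                            ∃ (Full X)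
  maximal-mutual-has-full {X} maximal with any? (λ c → top c ∈? X ×-dec bottom c ∈? X)
  ... | yes full = full
  ... | no none  = ⊥-elim ([ add-bottom , add-top ]′ (maximal-mutual-meets-columns maximal zero))
    where
    only-zero : ∀ {l} → Full X l ⊎ l ≡ zero → l ≡ zero
    only-zero = [ (λ full → ⊥-elim (none (_ , full))) , id ]′
    add-bottom : top zero ∈ X → ⊥
    add-bottom top-0∈X =
      maximal⇒¬∪⁅⁆ {Prism m} maximal (λ bottom-0∈X → none (zero , top-0∈X , bottom-0∈X))
      (at-most-one-full⇒mutual λ full full′ →
        trans (only-zero (full-∪⁅bottom⁆ full)) (sym (only-zero (full-∪⁅bottom⁆ full′))))
    add-top : bottom zero ∈ X → ⊥
    add-top bottom-0∈X =
      maximal⇒¬∪⁅⁆ {Prism m} maximal (λ top-0∈X → none (zero , top-0∈X , bottom-0∈X))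
      (at-most-one-full⇒mutual λ full full′ →
        trans (only-zero (full-∪⁅top⁆ full)) (sym (only-zero (full-∪⁅top⁆ full′))))

  maximal-mutual-size : ∀ {X} → Maximal (Prism m) (IsMutualVisibility (Prism m)) X →
                        suc m ≤ ∣ X ∣
  maximal-mutual-size {X} maximal with Vec.splitAt m X | maximal-mutual-has-full maximal
  ... | A , B , refl | c , top-c∈ , bottom-c∈ = begin
    1 + m                  ≤⟨ +-mono-≤ (∈⇒1≤∣p∣ shared) (full⊆p⇒n≤∣p∣ covered) ⟩
    ∣ A ∩ B ∣ + ∣ A ∪ B ∣  ≡⟨ +-comm ∣ A ∩ B ∣ ∣ A ∪ B ∣ ⟩
    ∣ A ∪ B ∣ + ∣ A ∩ B ∣  ≡⟨ ∣p∪q∣+∣p∩q∣≡∣p∣+∣q∣ A B ⟩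
    ∣ A ∣ + ∣ B ∣          ≡⟨ sym (∣p++q∣≡∣p∣+∣q∣ A B) ⟩
    ∣ A ++ B ∣             ∎
    where
    open ≤-Reasoning
    covered : full ⊆ A ∪ B
    covered {i} _ =
      x∈p∪q⁺ (Sum.map (∈-++ˡ⁻ A B) (∈-++ʳ⁻ A B) (maximal-mutual-meets-columns maximal i))
    shared : c ∈ A ∩ B
    shared = x∈p∩q⁺ (∈-++ˡ⁻ A B top-c∈ , ∈-++ʳ⁻ A B bottom-c∈)

  top-layer∪⁅bottom0⁆ : Subset (m + m)
  top-layer∪⁅bottom0⁆ = layers full ⁅ zero ⁆

  top-layer∪⁅bottom0⁆-maximal :
    Maximal (Prism m) (IsMutualVisibility (Prism m)) top-layer∪⁅bottom0⁆
  top-layer∪⁅bottom0⁆-maximal = at-most-one-full⇒mutual only-column-zero , no-mutual-superset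
    where
    bottom∈⇒≡0 : ∀ {i} → bottom i ∈ top-layer∪⁅bottom0⁆ → i ≡ zero
    bottom∈⇒≡0 = x∈⁅y⁆⇒x≡y zero ∘ ∈-++ʳ⁻ full ⁅ zero ⁆
    only-column-zero : AtMostOneFull top-layer∪⁅bottom0⁆
    only-column-zero (_ , bottom-i∈) (_ , bottom-j∈) =
      trans (bottom∈⇒≡0 bottom-i∈) (sym (bottom∈⇒≡0 bottom-j∈))
    top∈ : ∀ {i} → top i ∈ top-layer∪⁅bottom0⁆
    top∈ = ∈-++ˡ⁺ full ⁅ zero ⁆ ∈⊤
    bottom-0∈ : bottom zero ∈ top-layer∪⁅bottom0⁆
    bottom-0∈ = ∈-++ʳ⁺ full ⁅ zero ⁆ (x∈⁅x⁆ zero)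
    no-mutual-superset : ∀ Y → top-layer∪⁅bottom0⁆ ⊂ Y → ¬ IsMutualVisibility (Prism m) Y
    no-mutual-superset Y (X⊆Y , x , x∈Y , x∉X) Y-mutual with layer x
    ... | is-top i    = x∉X top∈
    ... | is-bottom j with j ≟ zero
    ...   | yes refl = x∉X bottom-0∈
    ...   | no j≢0   = j≢0 (mutual⇒at-most-one-full Y-mutual
                              (X⊆Y top∈ , x∈Y) (X⊆Y top∈ , X⊆Y bottom-0∈))

  prism-μ⁻ : IsMuMinus (Prism m) (suc m)
  prism-μ⁻ = (top-layer∪⁅bottom0⁆ , top-layer∪⁅bottom0⁆-maximal , size) , λ X → maximal-mutual-size
    where
    size : ∣ top-layer∪⁅bottom0⁆ ∣ ≡ suc m
    size = trans (∣p++q∣≡∣p∣+∣q∣ {m} {m} full ⁅ zero ⁆)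
                 (trans (cong₂ _+_ (∣⊤∣≡n m) (∣⁅x⁆∣≡1 {m} zero)) (+-comm m 1))

  column-0-maximal : Maximal (Prism m) (IsTotalMutualVisibility (Prism m)) (column zero)
  column-0-maximal = column-total zero , no-total-superset
    where
    no-total-superset : ∀ Y → column zero ⊂ Y → ¬ IsTotalMutualVisibility (Prism m) Y
    no-total-superset Y (X⊆Y , x , x∈Y , x∉X) Y-total with layer x
    ... | is-top j with j ≟ zero
    ...   | yes refl = x∉X (top∈column zero)
    ...   | no j≢0   = j≢0 (sym (total⇒no-crossing Y-total x∈Y (X⊆Y (bottom∈column zero))))
    no-total-superset Y (X⊆Y , x , x∈Y , x∉X) Y-total | is-bottom i with i ≟ zero
    ...   | yes refl = x∉X (bottom∈column zero)
    ...   | no i≢0   = i≢0 (total⇒no-crossing Y-total (X⊆Y (top∈column zero)) x∈Y)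

  prism-μ⁻t : IsMuTMinus (Prism m) 2
  prism-μ⁻t = (column zero , column-0-maximal , ∣column∣≡2 zero) ,
              λ X → 2≤∣maximal∣ {Prism m} total-⊆ (top zero) other-end-of-rung
    where
    other-end-of-rung : ∀ x → ∃ λ y → y ≢ x × IsTotalMutualVisibility (Prism m) (⁅ x ⁆ ∪ ⁅ y ⁆)
    other-end-of-rung x with layer x
    ... | is-top i    = bottom i , top≢bottom ∘ sym , column-total i
    ... | is-bottom i =
      top i , top≢bottom , no-crossing⇒total (in-column⇒no-crossing (swap ∘ ∈-pair⁻))

corollary5p3 : (k : ℕ) →
    (Σ Graph λ G → Connected G × Σ ℕ λ m → Σ ℕ λ mt →
      IsMuMinus G m × IsMuTMinus G mt × m ≡ mt + k) ×
    (Σ Graph λ H → Connected H × Σ ℕ λ m → Σ ℕ λ mt →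
      IsMuMinus H m × IsMuTMinus H mt × mt ≡ m + k)
corollary5p3 k =
  (Prism (suc k) , PrismProperties.prism-connected (suc k) , suc (suc k) , 2 ,
    prism-μ⁻ k , prism-μ⁻t k , refl) ,
  (Star (suc (suc k)) , star-connected , 2 , suc (suc k) ,
    star-μ⁻ k , star-μ⁻t k , refl)
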